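{- Let $k\ge 9$ and $r\ge 3$ be integers, let $B$ be a $3k\times 3k$ binary matrix and let $P$ be an $r$-repetition-free $k$-permutation matrix. If $B$ has at most $(1/3)(k/r)^{1/3}$ $0$-entries in every row and in every column, then $B$ contains $P$. Moreover, some occurrence of $P$ in $B$ uses $k$ consecutive rows of $B$.
   Context: A $k$-permutation matrix is a $k\times k$ binary matrix with exactly one $1$-entry in every row and every column. A binary matrix $A$ contains a binary matrix $B$ if $B$ can be obtained from $A$ by deleting some rows, some columns, and changing some $1$-entries to $0$-entries; an occurrence of $P$ is a choice of rows and columns realizing this. The distance vector from the $1$-entry at $(i_1,j_1)$ to the $1$-entry at $(i_2,j_2)$ is $(i_2-i_1,j_2-j_1)$. A vector is $r$-repeated in $P$ if it is the distance vector of at least $r$ pairs of $1$-entries of $P$; $P$ is $r$-repetition-free if no vector is $r$-repeated in $P$. -}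

module Defs where

open import Data.Nat using (ℕ; _+_; _*_; _^_; _≤_)
open import Data.Bool using (Bool; true; false; if_then_else_)
open import Data.Fin using (Fin; toℕ) renaming (_<_ to _<ᶠ_)
open import Data.List using (List; map; allFin)
open import Data.Nat.ListAction using (sum)
open import Data.Integer using (ℤ) renaming (_-_ to _-ℤ_; +_ to ⁺_)
open import Data.Product using (Σ; _×_; _,_; ∃)
open import Relation.Binary.PropositionalEquality using (_≡_; _≢_)
open import Relation.Nullary using (¬_)
open import Function.Definitions using (Injective)

BMatrix : ℕ → ℕ → Set
BMatrix m n = Fin m → Fin n → Bool

IsPermMatrix : {k : ℕ} → BMatrix k k → Set
IsPermMatrix {k} P =
  ((i : Fin k) → Σ (Fin k) λ j → (P i j ≡ true) × ((j' : Fin k) → P i j' ≡ true → j' ≡ j)) ×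
  ((j : Fin k) → Σ (Fin k) λ i → (P i j ≡ true) × ((i' : Fin k) → P i' j ≡ true → i' ≡ i))

Pos : ℕ → Set
Pos k = Fin k × Fin k

distVec : {k : ℕ} → Pos k → Pos k → ℤ × ℤ
distVec (i₁ , j₁) (i₂ , j₂) = ((⁺ toℕ i₂) -ℤ (⁺ toℕ i₁)) , ((⁺ toℕ j₂) -ℤ (⁺ toℕ j₁))

PairWithVec : {k : ℕ} → BMatrix k k → ℤ × ℤ → Set
PairWithVec {k} P v =
  Σ (Pos k × Pos k) λ { ((i₁ , j₁) , (i₂ , j₂)) →
    (P i₁ j₁ ≡ true) × (P i₂ j₂ ≡ true) × ((i₁ , j₁) ≢ (i₂ , j₂)) ×
    (distVec (i₁ , j₁) (i₂ , j₂) ≡ v) }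

RRepeated : {k : ℕ} → ℕ → BMatrix k k → ℤ × ℤ → Set
RRepeated {k} r P v =
  Σ (Fin r → PairWithVec P v) λ f →
    Injective _≡_ _≡_ (λ x → Data.Product.proj₁ (f x))

RepetitionFree : {k : ℕ} → ℕ → BMatrix k k → Set
RepetitionFree r P = (v : ℤ × ℤ) → ¬ RRepeated r P v

zerosInRow : {m n : ℕ} → BMatrix m n → Fin m → ℕ
zerosInRow {m} {n} B i = sum (map (λ j → if B i j then 0 else 1) (allFin n))

zerosInCol : {m n : ℕ} → BMatrix m n → Fin n → ℕ
zerosInCol {m} {n} B j = sum (map (λ i → if B i j then 0 else 1) (allFin m))

StrictlyIncreasing : {a b : ℕ} → (Fin a → Fin b) → Set
StrictlyIncreasing {a} f = (x y : Fin a) → x <ᶠ y → f x <ᶠ f y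

Occurrence : {m n k l : ℕ} → BMatrix m n → BMatrix k l → Set
Occurrence {m} {n} {k} {l} B P =
  Σ (Fin k → Fin m) λ rows → Σ (Fin l → Fin n) λ cols →
    StrictlyIncreasing rows × StrictlyIncreasing cols ×
    ((i : Fin k) (j : Fin l) → P i j ≡ true → B (rows i) (cols j) ≡ true)

Contains : {m n k l : ℕ} → BMatrix m n → BMatrix k l → Set
Contains B P = Occurrence B P

UsesConsecutiveRows : {m n k l : ℕ} (B : BMatrix m n) (P : BMatrix k l) →
  Occurrence B P → Set
UsesConsecutiveRows {k = k} B P (rows , _) =
  Σ ℕ λ s → (i : Fin k) → toℕ (rows i) ≡ s + toℕ i

-- z ≤ (1/3)(k/r)^(1/3)  ⇔  27 · z³ · r ≤ k   (for z ≥ 0, r ≥ 1).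
ZeroBound : ℕ → ℕ → ℕ → Set
ZeroBound k r z = 27 * z ^ 3 * r ≤ k

-- For each of the 2k + 1 windows of k consecutive rows of B, embed P greedily: scan the columns of B
-- from left to right and place the next column j of P at the first column having a 1 in the window row
-- of the 1-entry of column j.  If some window places all k columns we are done.  Otherwise each window
-- misses more than 2k of the 3k columns.  Let Z bound the 0-entries of every row and column.  A missed
-- column c with c + Z < 3k is either followed by a placement at c + Z (fewer than k times), or yields a
-- witness: a 0-entry at (a, c) starting a run of l ≤ Z zeros and a 0-entry at (a′, c + 1 + e), e < Z,
-- whose rows carry two 1-entries of P with distance vector (a′ − a, 1 + e − l).  So every failing window
-- has at least k + 2 − Z witnesses.  The vector does not depend on the window, so repetition-freeness
-- lets fewer than r windows share a witness, and there are at most 3k · Z³ witnesses; hence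
-- (2k + 1)(k + 2) ≤ 3k · rZ³ + (2k + 1) Z, contradicting 27 rZ³ ≤ k and 81 Z ≤ k.

module Submission where

open import Defs
open import Level using (0ℓ)
open import Data.Bool using (Bool; true; false; if_then_else_; _∧_)
open import Data.Bool.Properties using (∧-zeroʳ)
open import Data.Nat
open import Data.Nat.Properties
open import Data.Nat.ListAction using (sum)
open import Data.Nat.Tactic.RingSolver using (solve-∀)
open import Data.Integer as ℤ using (ℤ; _⊖_) renaming (+_ to ⁺_)
import Data.Integer.Properties as ℤ
open import Data.Fin using (Fin; toℕ; fromℕ<) renaming (zero to fzero; suc to fsuc)
open import Data.Fin.Properties using (toℕ<n; fromℕ<-toℕ; toℕ-fromℕ<; any?)
open import Data.List using (List; tabulate; _++_)
open import Data.List.Properties using (map-tabulate)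
open import Data.List.Extrema.Nat using (max; xs≤max; argmax-all)
open import Data.List.Relation.Unary.All using (All)
open import Data.List.Relation.Unary.All.Properties using (++⁺; ++⁻; tabulate⁺; tabulate⁻)
open import Data.Product using (Σ; ∃; _×_; _,_; proj₁; proj₂)
open import Data.Sum using (inj₁; inj₂)
open import Data.Empty using (⊥; ⊥-elim)
open import Function using (_∘_; id)
open import Function.Definitions using (Injective)
open import Relation.Nullary using (Dec; does; yes; no; ¬_; contradiction)
open import Relation.Nullary.Decidable using (_×-dec_)
open import Relation.Unary using (Pred; Decidable)
open import Relation.Binary.PropositionalEquality
open import Algebra.Properties.CommutativeSemigroup +-commutativeSemigroup using (interchange; x∙yz≈y∙xz)

∑< : ℕ → (ℕ → ℕ) → ℕ
∑< zero    f = 0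
∑< (suc n) f = f 0 + ∑< n (f ∘ suc)

syntax ∑< n (λ x → e) = ∑[ x < n ] e

∑<-cong : ∀ n {f g : ℕ → ℕ} → (∀ x → x < n → f x ≡ g x) → ∑< n f ≡ ∑< n g
∑<-cong zero    f≡g = refl
∑<-cong (suc n) f≡g = cong₂ _+_ (f≡g 0 z<s) (∑<-cong n (λ x x<n → f≡g (suc x) (s<s x<n)))

∑<-mono-≤ : ∀ n {f g : ℕ → ℕ} → (∀ x → x < n → f x ≤ g x) → ∑< n f ≤ ∑< n g
∑<-mono-≤ zero    f≤g = z≤n
∑<-mono-≤ (suc n) f≤g = +-mono-≤ (f≤g 0 z<s) (∑<-mono-≤ n (λ x x<n → f≤g (suc x) (s<s x<n)))

∑<-distrib-+ : ∀ n (f g : ℕ → ℕ) → ∑[ x < n ] (f x + g x) ≡ ∑< n f + ∑< n g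
∑<-distrib-+ zero    f g = refl
∑<-distrib-+ (suc n) f g =
  trans (cong (f 0 + g 0 +_) (∑<-distrib-+ n (f ∘ suc) (g ∘ suc))) (interchange (f 0) (g 0) _ _)

∑<-const : ∀ n c → ∑[ _ < n ] c ≡ n * c
∑<-const zero    c = refl
∑<-const (suc n) c = cong (c +_) (∑<-const n c)

∑<-comm : ∀ m n (f : ℕ → ℕ → ℕ) → ∑[ x < m ] ∑[ y < n ] f x y ≡ ∑[ y < n ] ∑[ x < m ] f x y
∑<-comm zero    n f = sym (trans (∑<-const n 0) (*-zeroʳ n))
∑<-comm (suc m) n f = begin
  ∑[ y < n ] f 0 y + ∑[ x < m ] ∑[ y < n ] f (suc x) y ≡⟨ cong (∑[ y < n ] f 0 y +_) (∑<-comm m n (f ∘ suc)) ⟩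
  ∑[ y < n ] f 0 y + ∑[ y < n ] ∑[ x < m ] f (suc x) y ≡⟨ ∑<-distrib-+ n (f 0) _ ⟨
  ∑[ y < n ] ∑[ x < suc m ] f x y                       ∎
  where open ≡-Reasoning

∑<-*ˡ : ∀ n c (f : ℕ → ℕ) → ∑[ x < n ] (c * f x) ≡ c * ∑< n f
∑<-*ˡ zero    c f = sym (*-zeroʳ c)
∑<-*ˡ (suc n) c f = trans (cong (c * f 0 +_) (∑<-*ˡ n c (f ∘ suc))) (sym (*-distribˡ-+ c (f 0) _))

∑<-+ : ∀ m n (f : ℕ → ℕ) → ∑< (m + n) f ≡ ∑< m f + ∑[ x < n ] f (m + x)
∑<-+ zero    n f = refl
∑<-+ (suc m) n f = trans (cong (f 0 +_) (∑<-+ m n (f ∘ suc))) (sym (+-assoc (f 0) _ _))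

∑<-suc : ∀ n (f : ℕ → ℕ) → ∑< (suc n) f ≡ ∑< n f + f n
∑<-suc n f = begin
  ∑< (suc n) f             ≡⟨ cong (λ m → ∑< m f) (+-comm 1 n) ⟩
  ∑< (n + 1) f             ≡⟨ ∑<-+ n 1 f ⟩
  ∑< n f + (f (n + 0) + 0) ≡⟨ cong (λ t → ∑< n f + t) (trans (+-identityʳ _) (cong f (+-identityʳ n))) ⟩
  ∑< n f + f n             ∎
  where open ≡-Reasoning

∑<-monoˡ-≤ : ∀ {m n} (f : ℕ → ℕ) → m ≤ n → ∑< m f ≤ ∑< n f
∑<-monoˡ-≤ {m} {n} f m≤n = begin
  ∑< m f                                 ≤⟨ m≤m+n _ _ ⟩
  ∑< m f + ∑[ x < n ∸ m ] f (m + x)      ≡⟨ ∑<-+ m (n ∸ m) f ⟨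
  ∑< (m + (n ∸ m)) f                     ≡⟨ cong (λ t → ∑< t f) (m+[n∸m]≡n m≤n) ⟩
  ∑< n f                                 ∎
  where open ≤-Reasoning

f≤∑< : ∀ n (f : ℕ → ℕ) {x} → x < n → f x ≤ ∑< n f
f≤∑< (suc n) f {zero}  _         = m≤m+n _ _
f≤∑< (suc n) f {suc x} (s<s x<n) = ≤-trans (f≤∑< n (f ∘ suc) x<n) (m≤n+m _ _)

∑<-≤-* : ∀ n (f : ℕ → ℕ) c → (∀ x → x < n → f x ≤ c) → ∑< n f ≤ n * c
∑<-≤-* n f c f≤c = ≤-trans (∑<-mono-≤ n f≤c) (≤-reflexive (∑<-const n c))

∑<-shift-≤ : ∀ n c (f : ℕ → ℕ) → (∀ x → n ≤ x → f x ≡ 0) → ∑[ m < n ] f (c + m) ≤ ∑< n f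
∑<-shift-≤ n c f vanish = begin
  ∑[ m < n ] f (c + m)              ≤⟨ m≤n+m _ _ ⟩
  ∑< c f + ∑[ m < n ] f (c + m)     ≡⟨ ∑<-+ c n f ⟨
  ∑< (c + n) f                      ≡⟨ cong (λ t → ∑< t f) (+-comm c n) ⟩
  ∑< (n + c) f                      ≡⟨ ∑<-+ n c f ⟩
  ∑< n f + ∑[ m < c ] f (n + m)     ≡⟨ cong (∑< n f +_) (∑<-cong c (λ m _ → vanish (n + m) (m≤m+n n m))) ⟩
  ∑< n f + ∑[ _ < c ] 0             ≡⟨ cong (∑< n f +_) (trans (∑<-const c 0) (*-zeroʳ c)) ⟩
  ∑< n f + 0                        ≡⟨ +-identityʳ _ ⟩
  ∑< n f                            ∎
  where open ≤-Reasoning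

isOne : Bool → ℕ
isOne b = if b then 1 else 0

isZero : Bool → ℕ
isZero b = if b then 0 else 1

isZero+isOne : ∀ b → isZero b + isOne b ≡ 1
isZero+isOne true  = refl
isZero+isOne false = refl

isOne-yes : ∀ {Q : Set} (Q? : Dec Q) → Q → isOne (does Q?) ≡ 1
isOne-yes (yes _) _ = refl
isOne-yes (no ¬q) q = contradiction q ¬q

count : {Q : Pred ℕ 0ℓ} → Decidable Q → ℕ → ℕ
count Q? n = ∑[ s < n ] isOne (does (Q? s))

Enumeration : Pred ℕ 0ℓ → ℕ → ℕ → Set
Enumeration Q n r = Σ (Fin r → ℕ) λ g → (∀ i → g i < n × Q (g i)) × Injective _≡_ _≡_ g

count≥⇒enumeration : ∀ {Q} (Q? : Decidable Q) n {r} → r ≤ count Q? n → Enumeration Q n r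
count≥⇒enumeration Q? zero {zero} _ = (λ ()) , (λ ()) , λ { {()} }
count≥⇒enumeration {Q} Q? (suc n) {r} r≤ with Q? 0
... | no _ = shift (count≥⇒enumeration (Q? ∘ suc) n r≤)
  where
  shift : Enumeration (Q ∘ suc) n r → Enumeration Q (suc n) r
  shift (g , g<Q , g-inj) = suc ∘ g , (λ i → s<s (proj₁ (g<Q i)) , proj₂ (g<Q i)) , g-inj ∘ suc-injective
... | yes q with r
...   | zero  = (λ ()) , (λ ()) , λ { {()} }
...   | suc r = cons (count≥⇒enumeration (Q? ∘ suc) n (s≤s⁻¹ r≤))
  where
  cons : Enumeration (Q ∘ suc) n r → Enumeration Q (suc n) (suc r)
  cons (g , g<Q , g-inj) = G , G<Q , G-inj
    where
    G : Fin (suc r) → ℕ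
    G fzero    = 0
    G (fsuc i) = suc (g i)
    G<Q : ∀ i → G i < suc n × Q (G i)
    G<Q fzero    = z<s , q
    G<Q (fsuc i) = s<s (proj₁ (g<Q i)) , proj₂ (g<Q i)
    G-inj : Injective _≡_ _≡_ G
    G-inj {fzero}  {fzero}  _  = refl
    G-inj {fsuc i} {fsuc j} eq = cong fsuc (g-inj (suc-injective eq))

leadingZeros : ℕ → (ℕ → Bool) → ℕ
leadingZeros zero    z = 0
leadingZeros (suc f) z = if z 0 then 0 else suc (leadingZeros f (z ∘ suc))

leadingZeros-false : ∀ f (z : ℕ → Bool) {m} → m < leadingZeros f z → z m ≡ false
leadingZeros-false (suc f) z {m} m< with z 0 in z0
leadingZeros-false (suc f) z {zero}  _         | false = z0
leadingZeros-false (suc f) z {suc m} (s<s m<) | false = leadingZeros-false f (z ∘ suc) m<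

leadingZeros-true : ∀ f (z : ℕ → Bool) → z f ≡ true → z (leadingZeros f z) ≡ true
leadingZeros-true zero    z zf = zf
leadingZeros-true (suc f) z zf with z 0 in z0
... | true  = z0
... | false = leadingZeros-true f (z ∘ suc) zf

leadingZeros≤∑ : ∀ f (z : ℕ → Bool) → leadingZeros f z ≤ ∑[ m < f ] isZero (z m)
leadingZeros≤∑ zero    z = z≤n
leadingZeros≤∑ (suc f) z with z 0
... | true  = z≤n
... | false = s≤s (leadingZeros≤∑ f (z ∘ suc))

firstFalse : ∀ (t : ℕ → Bool) {b} d → t b ≡ true → t (b + d) ≡ false →
  ∃ λ e → e < d × (∀ m → m ≤ e → t (b + m) ≡ true) × t (b + suc e) ≡ false
firstFalse t {b} zero    tb tb+d with trans (sym tb) (trans (cong t (sym (+-identityʳ b))) tb+d)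
... | ()
firstFalse t {b} (suc d) tb tb+d with t (suc b) in tsb
... | false = 0 , z<s , (λ { zero _ → trans (cong t (+-identityʳ b)) tb }) , trans (cong t (+-comm b 1)) tsb
... | true  with firstFalse t {suc b} d tsb (trans (cong t (sym (+-suc b d))) tb+d)
...   | e , e<d , run , tend = suc e , s<s e<d , run′ , trans (cong t (+-suc b (suc e))) tend
  where
  run′ : ∀ m → m ≤ suc e → t (b + m) ≡ true
  run′ zero    _         = trans (cong t (+-identityʳ b)) tb
  run′ (suc m) (s≤s m≤e) = trans (cong t (+-suc b m)) (run m m≤e)

sum-tabulate : ∀ n (h : Fin n → ℕ) (g : ℕ → ℕ) → (∀ i → h i ≡ g (toℕ i)) → sum (tabulate h) ≡ ∑< n g
sum-tabulate zero    h g h≡g = refl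
sum-tabulate (suc n) h g h≡g = cong₂ _+_ (h≡g _) (sum-tabulate n (h ∘ fsuc) (g ∘ suc) (h≡g ∘ fsuc))

-- Padding with 1-entries keeps the zero counts and makes every run of 0-entries end inside the matrix.
extend : ∀ {m n} → BMatrix m n → ℕ → ℕ → Bool
extend {m} {n} B a c with a <? m | c <? n
... | yes a<m | yes c<n = B (fromℕ< a<m) (fromℕ< c<n)
... | _       | _       = true

module _ {m n} (B : BMatrix m n) where

  extend-toℕ : ∀ i j → extend B (toℕ i) (toℕ j) ≡ B i j
  extend-toℕ i j with toℕ i <? m | toℕ j <? n
  ... | yes i<m | yes j<n = cong₂ B (fromℕ<-toℕ i i<m) (fromℕ<-toℕ j j<n)
  ... | no i≮m  | _       = ⊥-elim (i≮m (toℕ<n i))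
  ... | yes _   | no j≮n  = ⊥-elim (j≮n (toℕ<n j))

  extend-outside : ∀ a c → ¬ (a < m × c < n) → extend B a c ≡ true
  extend-outside a c out with a <? m | c <? n
  ... | yes a<m | yes c<n = ⊥-elim (out (a<m , c<n))
  ... | yes _   | no _    = refl
  ... | no _    | _       = refl

  zerosInRow≡∑ : ∀ i → zerosInRow B i ≡ ∑[ c < n ] isZero (extend B (toℕ i) c)
  zerosInRow≡∑ i = trans (cong sum (map-tabulate id (isZero ∘ B i)))
    (sum-tabulate n _ _ (λ j → cong isZero (sym (extend-toℕ i j))))

  zerosInCol≡∑ : ∀ j → zerosInCol B j ≡ ∑[ a < m ] isZero (extend B a (toℕ j))
  zerosInCol≡∑ j = trans (cong sum (map-tabulate id (λ i → isZero (B i j))))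
    (sum-tabulate m _ _ (λ i → cong isZero (sym (extend-toℕ i j))))

liftℕ : ∀ {k} → (Fin k → Fin k) → ℕ → ℕ
liftℕ {k} f x with x <? k
... | yes x<k = toℕ (f (fromℕ< x<k))
... | no  _   = 0

module _ {k} (f : Fin k → Fin k) where

  liftℕ-toℕ : ∀ i → liftℕ f (toℕ i) ≡ toℕ (f i)
  liftℕ-toℕ i with toℕ i <? k
  ... | yes i<k = cong (toℕ ∘ f) (fromℕ<-toℕ i i<k)
  ... | no  i≮k = ⊥-elim (i≮k (toℕ<n i))

  liftℕ-< : ∀ {x} → x < k → liftℕ f x < k
  liftℕ-< {x} x<k with x <? k
  ... | yes _   = toℕ<n _
  ... | no  x≮k = ⊥-elim (x≮k x<k)

liftℕ-inverse : ∀ {k} (f g : Fin k → Fin k) → (∀ j → f (g j) ≡ j) → ∀ {x} → x < k → liftℕ f (liftℕ g x) ≡ x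
liftℕ-inverse {k} f g fg {x} x<k with x <? k
... | yes x<k = trans (liftℕ-toℕ f (g _)) (trans (cong toℕ (fg _)) (toℕ-fromℕ< x<k))
... | no  x≮k = ⊥-elim (x≮k x<k)

-- Column j of P has its 1-entry in row σ j.  Scanning the columns p of A from left to right, the next
-- column j of P is placed at p when A (s + σ j) p = 1; matched s p counts the columns placed before p.
module Greedy (A : ℕ → ℕ → Bool) (k : ℕ) (σ : ℕ → ℕ) where

  fits : ℕ → ℕ → ℕ → Bool
  fits s j p = (j <ᵇ k) ∧ A (s + σ j) p

  matched : ℕ → ℕ → ℕ
  matched s zero    = 0
  matched s (suc p) = matched s p + isOne (fits s (matched s p) p)

  takes : ℕ → ℕ → Bool
  takes s p = fits s (matched s p) p

  matched-mono : ∀ s {p q} → p ≤ q → matched s p ≤ matched s q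
  matched-mono s {q = zero}  z≤n = ≤-refl
  matched-mono s {q = suc q} p≤1+q with m≤n⇒m<n∨m≡n p≤1+q
  ... | inj₁ p<1+q = ≤-trans (matched-mono s (s≤s⁻¹ p<1+q)) (m≤m+n _ _)
  ... | inj₂ refl  = ≤-refl

  ∑-takes : ∀ s n → ∑[ p < n ] isOne (takes s p) ≡ matched s n
  ∑-takes s zero    = refl
  ∑-takes s (suc n) = trans (∑<-suc n _) (cong (_+ isOne (takes s n)) (∑-takes s n))

  takes⇒one : ∀ s p → takes s p ≡ true → A (s + σ (matched s p)) p ≡ true
  takes⇒one s p t with matched s p <ᵇ k
  ... | true = t

  one⇒takes : ∀ s p → matched s p < k → A (s + σ (matched s p)) p ≡ true → takes s p ≡ true
  one⇒takes s p j<k a with matched s p <ᵇ k | <⇒<ᵇ j<k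
  ... | true | _ = a

  misses⇒zero : ∀ s p → matched s p < k → takes s p ≡ false → A (s + σ (matched s p)) p ≡ false
  misses⇒zero s p j<k t with matched s p <ᵇ k | <⇒<ᵇ j<k
  ... | true | _ = t

  zero⇒misses : ∀ s p → A (s + σ (matched s p)) p ≡ false → takes s p ≡ false
  zero⇒misses s p a = trans (cong ((matched s p <ᵇ k) ∧_) a) (∧-zeroʳ _)

  matched-skipsZeros : ∀ s c l → (∀ m → m < l → A (s + σ (matched s c)) (c + m) ≡ false) →
    matched s (c + l) ≡ matched s c
  matched-skipsZeros s c zero    zeros = cong (matched s) (+-identityʳ c)
  matched-skipsZeros s c (suc l) zeros = begin
    matched s (c + suc l)                        ≡⟨ cong (matched s) (+-suc c l) ⟩
    matched s (c + l) + isOne (takes s (c + l))  ≡⟨ cong (λ t → matched s (c + l) + isOne t) (zero⇒misses s (c + l) zero′) ⟩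
    matched s (c + l) + 0                        ≡⟨ +-identityʳ _ ⟩
    matched s (c + l)                            ≡⟨ IH ⟩
    matched s c                                  ∎
    where
    open ≡-Reasoning
    IH : matched s (c + l) ≡ matched s c
    IH = matched-skipsZeros s c l (λ m m<l → zeros m (m<n⇒m<1+n m<l))
    zero′ : A (s + σ (matched s (c + l))) (c + l) ≡ false
    zero′ = subst (λ j → A (s + σ j) (c + l) ≡ false) (sym IH) (zeros l ≤-refl)

  matched-takesRun : ∀ s b d → (∀ m → m < d → takes s (b + m) ≡ true) → matched s (b + d) ≡ matched s b + d
  matched-takesRun s b zero    _    = trans (cong (matched s) (+-identityʳ b)) (sym (+-identityʳ _))
  matched-takesRun s b (suc d) take = begin
    matched s (b + suc d)                          ≡⟨ cong (matched s) (+-suc b d) ⟩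
    matched s (b + d) + isOne (takes s (b + d))    ≡⟨ cong (λ t → matched s (b + d) + isOne t) (take d ≤-refl) ⟩
    matched s (b + d) + 1                          ≡⟨ cong (_+ 1) (matched-takesRun s b d (λ m m<d → take m (m<n⇒m<1+n m<d))) ⟩
    matched s b + d + 1                            ≡⟨ trans (+-assoc _ d 1) (cong (matched s b +_) (+-comm d 1)) ⟩
    matched s b + suc d                            ∎
    where open ≡-Reasoning

  matched-reaches : ∀ s n {j} → j < matched s n → ∃ λ p → p < n × matched s p ≡ j × takes s p ≡ true
  matched-reaches s (suc n) {j} j< with j <? matched s n
  ... | yes j<n = let p , p<n , eq , t = matched-reaches s n j<n in p , m<n⇒m<1+n p<n , eq , t
  ... | no  j≮n with takes s n in t
  ...   | true  = n , ≤-refl , ≤-antisym (≮⇒≥ j≮n) (s≤s⁻¹ (<-≤-trans j< (≤-reflexive (+-comm _ 1)))) , t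
  ...   | false = ⊥-elim (j≮n (<-≤-trans j< (≤-reflexive (+-identityʳ _))))

module PermutationMatrix {k} {P : BMatrix k k} (perm : IsPermMatrix P) where

  π : Fin k → Fin k
  π i = proj₁ (proj₁ perm i)

  σ : Fin k → Fin k
  σ j = proj₁ (proj₂ perm j)

  P-π : ∀ i → P i (π i) ≡ true
  P-π i = proj₁ (proj₂ (proj₁ perm i))

  P⇒σ : ∀ {i j} → P i j ≡ true → i ≡ σ j
  P⇒σ {i} {j} = proj₂ (proj₂ (proj₂ perm j)) i

  π∘σ : ∀ j → π (σ j) ≡ j
  π∘σ j = sym (proj₂ (proj₂ (proj₁ perm (σ j))) j (proj₁ (proj₂ (proj₂ perm j))))

module GreedyEmbedding (k : ℕ) (B : BMatrix (3 * k) (3 * k)) {P : BMatrix k k} (perm : IsPermMatrix P) where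

  open PermutationMatrix perm public

  N : ℕ
  N = 3 * k

  A : ℕ → ℕ → Bool
  A = extend B

  open Greedy A k (liftℕ σ) public

  occurrence : ∀ s → s + k ≤ N → k ≤ matched s N → Σ (Occurrence B P) (UsesConsecutiveRows B P)
  occurrence s s+k≤N k≤m = (rows , cols , rows-inc , cols-inc , ones) , s , λ i → toℕ-fromℕ< (row< i)
    where
    reach : ∀ (j : Fin k) → ∃ λ p → p < N × matched s p ≡ toℕ j × takes s p ≡ true
    reach j = matched-reaches s N (<-≤-trans (toℕ<n j) k≤m)
    col : Fin k → ℕ
    col j = proj₁ (reach j)
    matched-col : ∀ j → matched s (col j) ≡ toℕ j
    matched-col j = proj₁ (proj₂ (proj₂ (reach j)))
    row< : ∀ (i : Fin k) → s + toℕ i < N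
    row< i = <-≤-trans (+-monoʳ-< s (toℕ<n i)) s+k≤N
    rows : Fin k → Fin N
    rows i = fromℕ< (row< i)
    cols : Fin k → Fin N
    cols j = fromℕ< (proj₁ (proj₂ (reach j)))
    rows-inc : StrictlyIncreasing rows
    rows-inc x y x<y = subst₂ _<_ (sym (toℕ-fromℕ< (row< x))) (sym (toℕ-fromℕ< (row< y))) (+-monoʳ-< s x<y)
    cols-inc : StrictlyIncreasing cols
    cols-inc x y x<y = subst₂ _<_ (sym (toℕ-fromℕ< _)) (sym (toℕ-fromℕ< _)) (≰⇒> col-y≰col-x)
      where
      col-y≰col-x : col y ≤ col x → ⊥
      col-y≰col-x le = <⇒≱ x<y (subst₂ _≤_ (matched-col y) (matched-col x) (matched-mono s le))
    ones : ∀ i j → P i j ≡ true → B (rows i) (cols j) ≡ true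
    ones i j Pij = begin
      B (rows i) (cols j)                                ≡⟨ extend-toℕ B (rows i) (cols j) ⟨
      A (toℕ (rows i)) (toℕ (cols j))                    ≡⟨ cong₂ A (toℕ-fromℕ< (row< i)) (toℕ-fromℕ< _) ⟩
      A (s + toℕ i) (col j)                              ≡⟨ cong (λ x → A (s + x) (col j)) row≡ ⟩
      A (s + liftℕ σ (matched s (col j))) (col j)        ≡⟨ takes⇒one s (col j) (proj₂ (proj₂ (proj₂ (reach j)))) ⟩
      true                                               ∎
      where
      open ≡-Reasoning
      row≡ : toℕ i ≡ liftℕ σ (matched s (col j))
      row≡ = trans (cong toℕ (P⇒σ Pij)) (trans (sym (liftℕ-toℕ σ j)) (cong (liftℕ σ) (sym (matched-col j))))

⁺m-⁺n≡⁺o-⁺p : ∀ m n o p → m + p ≡ n + o → ⁺ m ℤ.- ⁺ n ≡ ⁺ o ℤ.- ⁺ p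
⁺m-⁺n≡⁺o-⁺p m n o p m+p≡n+o = begin
  ⁺ m ℤ.- ⁺ n        ≡⟨ ℤ.m-n≡m⊖n m n ⟩
  m ⊖ n              ≡⟨ ℤ.+-cancelˡ-⊖ p m n ⟨
  (p + m) ⊖ (p + n)  ≡⟨ cong₂ _⊖_ (trans (+-comm p m) m+p≡n+o) (+-comm p n) ⟩
  (n + o) ⊖ (n + p)  ≡⟨ ℤ.+-cancelˡ-⊖ n o p ⟩
  o ⊖ p              ≡⟨ ℤ.m-n≡m⊖n o p ⟨
  ⁺ o ℤ.- ⁺ p        ∎
  where open ≡-Reasoning

failingWindow-arith : ∀ k Z X m → 3 * k ∸ Z ≤ X + m + m → m < k → k + 2 ≤ X + Z
failingWindow-arith k Z X m le m<k = +-cancelʳ-≤ (2 * k) (k + 2) (X + Z) (begin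
  k + 2 + 2 * k        ≡⟨ e₁ k ⟩
  3 * k + 2            ≤⟨ +-monoˡ-≤ 2 (m≤n+m∸n (3 * k) Z) ⟩
  Z + (3 * k ∸ Z) + 2  ≤⟨ +-monoˡ-≤ 2 (+-monoʳ-≤ Z le) ⟩
  Z + (X + m + m) + 2  ≡⟨ e₂ Z X m ⟩
  X + Z + 2 * suc m    ≤⟨ +-monoʳ-≤ (X + Z) (*-monoʳ-≤ 2 m<k) ⟩
  X + Z + 2 * k        ∎)
  where
  open ≤-Reasoning
  e₁ : ∀ k → k + 2 + 2 * k ≡ 3 * k + 2
  e₁ = solve-∀
  e₂ : ∀ Z X m → Z + (X + m + m) + 2 ≡ X + Z + 2 * suc m
  e₂ = solve-∀

n≤n³ : ∀ n → n ≤ n ^ 3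
n≤n³ zero    = z≤n
n≤n³ (suc n) = m≤m*n (suc n) (suc n ^ 2)

zeroBound⇒81Z≤k : ∀ {k r Z} → 3 ≤ r → ZeroBound k r Z → 81 * Z ≤ k
zeroBound⇒81Z≤k {k} {r} {Z} r≥3 bound = begin
  81 * Z          ≤⟨ *-monoʳ-≤ 81 (n≤n³ Z) ⟩
  81 * Z ^ 3      ≡⟨ e Z ⟩
  27 * Z ^ 3 * 3  ≤⟨ *-monoʳ-≤ (27 * Z ^ 3) r≥3 ⟩
  27 * Z ^ 3 * r  ≤⟨ bound ⟩
  k               ∎
  where
  open ≤-Reasoning
  e : ∀ Z → 81 * (Z * (Z * (Z * 1))) ≡ 27 * (Z * (Z * (Z * 1))) * 3
  e = solve-∀

zeroBound⇒27rZ³≤k : ∀ {k r Z} → ZeroBound k r Z → 27 * (r * (Z * Z) * Z) ≤ k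
zeroBound⇒27rZ³≤k {r = r} {Z} = ≤-trans (≤-reflexive (e r Z))
  where
  e : ∀ r Z → 27 * (r * (Z * Z) * Z) ≡ 27 * (Z * (Z * (Z * 1))) * r
  e = solve-∀

manyWindows-arith : ∀ k Z W → 81 * Z ≤ k → 27 * W ≤ k → ¬ (suc (2 * k) * (k + 2) ≤ 3 * k * W + suc (2 * k) * Z)
manyWindows-arith k Z W 81Z≤k 27W≤k le = <⇒≱ small big
  where
  open ≤-Reasoning
  e₁ : ∀ k W Z → 81 * (3 * k * W + suc (2 * k) * Z) ≡ 9 * k * (27 * W) + suc (2 * k) * (81 * Z)
  e₁ = solve-∀
  e₂ : ∀ k → 9 * k * k + suc (2 * k) * k ≡ 11 * (k * k) + k
  e₂ = solve-∀
  e₃ : ∀ k → 81 * (suc (2 * k) * (k + 2)) ≡ suc (11 * (k * k) + k) + (151 * (k * k) + 404 * k + 161)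
  e₃ = solve-∀
  big : 81 * (suc (2 * k) * (k + 2)) ≤ 11 * (k * k) + k
  big = begin
    81 * (suc (2 * k) * (k + 2))                 ≤⟨ *-monoʳ-≤ 81 le ⟩
    81 * (3 * k * W + suc (2 * k) * Z)           ≡⟨ e₁ k W Z ⟩
    9 * k * (27 * W) + suc (2 * k) * (81 * Z)    ≤⟨ +-mono-≤ (*-monoʳ-≤ (9 * k) 27W≤k) (*-monoʳ-≤ (suc (2 * k)) 81Z≤k) ⟩
    9 * k * k + suc (2 * k) * k                  ≡⟨ e₂ k ⟩
    11 * (k * k) + k                             ∎
  small : 11 * (k * k) + k < 81 * (suc (2 * k) * (k + 2))
  small = ≤-trans (m≤m+n _ _) (≤-reflexive (sym (e₃ k)))

module WitnessCounting (k : ℕ) (B : BMatrix (3 * k) (3 * k)) {P : BMatrix k k} (perm : IsPermMatrix P) (Z : ℕ)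
  (rowZeros≤Z : ∀ a → a < 3 * k → ∑[ c < 3 * k ] isZero (extend B a c) ≤ Z)
  (colZeros≤Z : ∀ c → ∑[ a < 3 * k ] isZero (extend B a c) ≤ Z) where

  open GreedyEmbedding k B perm public

  A-outside : ∀ a c → N ≤ c → A a c ≡ true
  A-outside a c N≤c = extend-outside B a c (λ (_ , c<N) → <⇒≱ c<N N≤c)

  zeroRun : ℕ → ℕ → ℕ
  zeroRun a c = leadingZeros N (λ m → A a (c + m))

  zeroRun-zero : ∀ a c m → m < zeroRun a c → A a (c + m) ≡ false
  zeroRun-zero a c m = leadingZeros-false N (λ m → A a (c + m))

  zeroRun-end : ∀ a c → A a (c + zeroRun a c) ≡ true
  zeroRun-end a c = leadingZeros-true N (λ m → A a (c + m)) (A-outside a (c + N) (m≤n+m N c))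

  zeroRun≤Z : ∀ a c → a < N → zeroRun a c ≤ Z
  zeroRun≤Z a c a<N = begin
    zeroRun a c                          ≤⟨ leadingZeros≤∑ N (λ m → A a (c + m)) ⟩
    ∑[ m < N ] isZero (A a (c + m))      ≤⟨ ∑<-shift-≤ N c (isZero ∘ A a) (λ x N≤x → cong isZero (A-outside a x N≤x)) ⟩
    ∑[ x < N ] isZero (A a x)            ≤⟨ rowZeros≤Z a a<N ⟩
    Z                                    ∎
    where open ≤-Reasoning

  InWindow : ℕ → ℕ → Set
  InWindow s a = s ≤ a × a < s + k

  -- The 1-entries of P in window rows a and a′ have distance vector (a′ − a, 1 + e − zeroRun a c),
  -- which does not depend on the window s.
  Witness : ℕ → ℕ → ℕ → ℕ → ℕ → Set
  Witness s c a a′ e = InWindow s a × InWindow s a′ ×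
    (liftℕ π (a′ ∸ s) + zeroRun a c ≡ liftℕ π (a ∸ s) + suc e) × zeroRun a c < suc e

  witness? : ∀ c a a′ e s → Dec (Witness s c a a′ e)
  witness? c a a′ e s = ((s ≤? a) ×-dec (a <? s + k)) ×-dec ((s ≤? a′) ×-dec (a′ <? s + k)) ×-dec
    (liftℕ π (a′ ∸ s) + zeroRun a c ≟ liftℕ π (a ∸ s) + suc e) ×-dec (zeroRun a c <? suc e)

  witnessTerm : ℕ → ℕ → ℕ → ℕ → ℕ → ℕ
  witnessTerm s c a a′ e = isZero (A a c) * (isZero (A a′ (c + suc e)) * isOne (does (witness? c a a′ e s)))

  witnesses : ℕ → ℕ → ℕ
  witnesses s c = ∑[ a < N ] ∑[ a′ < N ] ∑[ e < Z ] witnessTerm s c a a′ e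

  witnessed : ∀ s c a a′ e → a < N → a′ < N → e < Z → A a c ≡ false → A a′ (c + suc e) ≡ false →
    Witness s c a a′ e → 1 ≤ witnesses s c
  witnessed s c a a′ e a<N a′<N e<Z zero-a zero-a′ w = begin
    1                                      ≡⟨ cong₂ _*_ (cong isZero zero-a) (cong₂ _*_ (cong isZero zero-a′) (isOne-yes (witness? c a a′ e s) w)) ⟨
    witnessTerm s c a a′ e                            ≤⟨ f≤∑< Z (witnessTerm s c a a′) e<Z ⟩
    ∑[ e < Z ] witnessTerm s c a a′ e                 ≤⟨ f≤∑< N (λ a′ → ∑[ e < Z ] witnessTerm s c a a′ e) a′<N ⟩
    ∑[ a′ < N ] ∑[ e < Z ] witnessTerm s c a a′ e     ≤⟨ f≤∑< N (λ a → ∑[ a′ < N ] ∑[ e < Z ] witnessTerm s c a a′ e) a<N ⟩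
    witnesses s c                                     ∎
    where open ≤-Reasoning

  module FailingWindow (s : ℕ) (s+k≤N : s + k ≤ N) (fails : matched s N < k) where

    rowOf : ℕ → ℕ
    rowOf j = s + liftℕ σ j

    rowOf-inWindow : ∀ {j} → j < k → InWindow s (rowOf j)
    rowOf-inWindow j<k = m≤m+n s _ , +-monoʳ-< s (liftℕ-< σ j<k)

    rowOf<N : ∀ {j} → j < k → rowOf j < N
    rowOf<N j<k = <-≤-trans (proj₂ (rowOf-inWindow j<k)) s+k≤N

    π-rowOf : ∀ {j} → j < k → liftℕ π (rowOf j ∸ s) ≡ j
    π-rowOf j<k = trans (cong (liftℕ π) (m+n∸m≡n s _)) (liftℕ-inverse π σ π∘σ j<k)

    matched<k : ∀ {p} → p ≤ N → matched s p < k
    matched<k p≤N = ≤-<-trans (matched-mono s p≤N) fails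

    takenAfterZeroRun : ∀ c → matched s c < k →
      let l = zeroRun (rowOf (matched s c)) c in matched s (c + l) ≡ matched s c × takes s (c + l) ≡ true
    takenAfterZeroRun c j<k = matched-c+l ,
      one⇒takes s (c + l) (subst (_< k) (sym matched-c+l) j<k)
        (subst (λ x → A (rowOf x) (c + l) ≡ true) (sym matched-c+l) (zeroRun-end (rowOf (matched s c)) c))
      where
      l : ℕ
      l = zeroRun (rowOf (matched s c)) c
      matched-c+l : matched s (c + l) ≡ matched s c
      matched-c+l = matched-skipsZeros s c l (zeroRun-zero (rowOf (matched s c)) c)

    missed⇒witnessed : ∀ c → Z + c < N → takes s c ≡ false → takes s (Z + c) ≡ false → 1 ≤ witnesses s c
    missed⇒witnessed c Z+c<N miss-c miss-Z+c = witnessFrom (firstFalse (takes s) (Z ∸ l) taken-c+l miss-end)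
      where
      j : ℕ
      j = matched s c
      j<k : j < k
      j<k = matched<k (≤-trans (m≤n+m c Z) (<⇒≤ Z+c<N))
      a l : ℕ
      a = rowOf j
      l = zeroRun a c
      l≤Z : l ≤ Z
      l≤Z = zeroRun≤Z a c (rowOf<N j<k)
      matched-c+l : matched s (c + l) ≡ j
      matched-c+l = proj₁ (takenAfterZeroRun c j<k)
      taken-c+l : takes s (c + l) ≡ true
      taken-c+l = proj₂ (takenAfterZeroRun c j<k)
      miss-end : takes s (c + l + (Z ∸ l)) ≡ false
      miss-end = subst (λ p → takes s p ≡ false)
        (sym (trans (+-assoc c l _) (trans (cong (c +_) (m+[n∸m]≡n l≤Z)) (+-comm c Z)))) miss-Z+c
      witnessFrom : (∃ λ e₀ → e₀ < Z ∸ l × (∀ m → m ≤ e₀ → takes s (c + l + m) ≡ true) × takes s (c + l + suc e₀) ≡ false) →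
        1 ≤ witnesses s c
      witnessFrom (e₀ , e₀<Z∸l , taken , miss) =
        witnessed s c a (rowOf j′) e (rowOf<N j<k) (rowOf<N j′<k) e<Z (misses⇒zero s c j<k miss-c)
          (misses⇒zero s (c + suc e) j′<k (subst (λ p → takes s p ≡ false) f≡ miss))
          (rowOf-inWindow j<k , rowOf-inWindow j′<k , π-relation , s≤s (m≤m+n l e₀))
        where
        e : ℕ
        e = l + e₀
        e<Z : e < Z
        e<Z = <-≤-trans (+-monoʳ-< l e₀<Z∸l) (≤-reflexive (m+[n∸m]≡n l≤Z))
        f≡ : c + l + suc e₀ ≡ c + suc e
        f≡ = trans (+-assoc c l (suc e₀)) (cong (c +_) (+-suc l e₀))
        j′ : ℕ
        j′ = matched s (c + suc e)
        j′≡ : j′ ≡ j + suc e₀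
        j′≡ = trans (cong (matched s) (sym f≡))
          (trans (matched-takesRun s (c + l) (suc e₀) (λ m m≤e₀ → taken m (s≤s⁻¹ m≤e₀))) (cong (_+ suc e₀) matched-c+l))
        j′<k : j′ < k
        j′<k = matched<k (<⇒≤ (≤-<-trans (≤-trans (+-monoʳ-≤ c e<Z) (≤-reflexive (+-comm c Z))) Z+c<N))
        π-relation : liftℕ π (rowOf j′ ∸ s) + l ≡ liftℕ π (a ∸ s) + suc e
        π-relation = begin
          liftℕ π (rowOf j′ ∸ s) + l  ≡⟨ cong (_+ l) (trans (π-rowOf j′<k) j′≡) ⟩
          j + suc e₀ + l              ≡⟨ trans (+-assoc j (suc e₀) l) (cong (λ x → j + suc x) (+-comm e₀ l)) ⟩
          j + suc e                   ≡⟨ cong (_+ suc e) (π-rowOf j<k) ⟨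
          liftℕ π (a ∸ s) + suc e     ∎
          where open ≡-Reasoning

    missed≤ : Z ≤ N → ∀ c → c < N ∸ Z → isZero (takes s c) ≤ witnesses s c + isOne (takes s (Z + c))
    missed≤ Z≤N c c<N∸Z with takes s c in miss-c | takes s (Z + c) in miss-Z+c
    ... | true  | _     = z≤n
    ... | false | true  = m≤n+m 1 _
    ... | false | false = ≤-trans (missed⇒witnessed c Z+c<N miss-c miss-Z+c) (m≤m+n _ _)
      where
      Z+c<N : Z + c < N
      Z+c<N = subst (_≤ N) (cong suc (+-comm c Z)) (m≤o∸n⇒m+n≤o (suc c) Z≤N c<N∸Z)

    lowerBound : Z ≤ N → k + 2 ≤ ∑[ c < N ] witnesses s c + Z
    lowerBound Z≤N = failingWindow-arith k Z _ _ (begin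
      N ∸ Z                                                                  ≡⟨ trans (∑<-const (N ∸ Z) 1) (*-identityʳ _) ⟨
      ∑[ c < N ∸ Z ] 1                                                        ≡⟨ ∑<-cong (N ∸ Z) (λ c _ → isZero+isOne (takes s c)) ⟨
      ∑[ c < N ∸ Z ] (isZero (takes s c) + isOne (takes s c))                 ≡⟨ ∑<-distrib-+ (N ∸ Z) _ _ ⟩
      ∑[ c < N ∸ Z ] isZero (takes s c) + ∑[ c < N ∸ Z ] isOne (takes s c)    ≤⟨ +-mono-≤ (∑<-mono-≤ (N ∸ Z) (missed≤ Z≤N)) (≤-reflexive (∑-takes s (N ∸ Z))) ⟩
      ∑[ c < N ∸ Z ] (witnesses s c + isOne (takes s (Z + c))) + matched s (N ∸ Z)
                                                                             ≡⟨ cong (_+ matched s (N ∸ Z)) (∑<-distrib-+ (N ∸ Z) _ _) ⟩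
      ∑[ c < N ∸ Z ] witnesses s c + ∑[ c < N ∸ Z ] isOne (takes s (Z + c)) + matched s (N ∸ Z)
                                                                             ≤⟨ +-mono-≤ (+-mono-≤ (∑<-monoˡ-≤ (witnesses s) (m∸n≤m N Z)) late) (matched-mono s (m∸n≤m N Z)) ⟩
      ∑[ c < N ] witnesses s c + matched s N + matched s N                   ∎) fails
      where
      open ≤-Reasoning
      late : ∑[ c < N ∸ Z ] isOne (takes s (Z + c)) ≤ matched s N
      late = begin
        ∑[ c < N ∸ Z ] isOne (takes s (Z + c))                               ≤⟨ m≤n+m _ _ ⟩
        ∑[ p < Z ] isOne (takes s p) + ∑[ c < N ∸ Z ] isOne (takes s (Z + c)) ≡⟨ ∑<-+ Z (N ∸ Z) _ ⟨
        ∑[ p < Z + (N ∸ Z) ] isOne (takes s p)                               ≡⟨ ∑-takes s (Z + (N ∸ Z)) ⟩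
        matched s (Z + (N ∸ Z))                                              ≡⟨ cong (matched s) (m+[n∸m]≡n Z≤N) ⟩
        matched s N                                                          ∎


  offset<k : ∀ {s a} → InWindow s a → a ∸ s < k
  offset<k {s} {a} (s≤a , a<s+k) = <-≤-trans (∸-monoˡ-< a<s+k s≤a) (≤-reflexive (m+n∸m≡n s k))

  module RepetitionFreeBound (r : ℕ) (rf : RepetitionFree r P) where

    witnessVector : ℕ → ℕ → ℕ → ℕ → ℤ × ℤ
    witnessVector c a a′ e = (⁺ a′ ℤ.- ⁺ a) , (⁺ suc e ℤ.- ⁺ zeroRun a c)

    witnessPair : ∀ {c a a′ e} s → Witness s c a a′ e →
      Σ (PairWithVec P (witnessVector c a a′ e)) λ pair → toℕ (proj₁ (proj₁ (proj₁ pair))) ≡ a ∸ s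
    witnessPair {c} {a} {a′} {e} s (win , win′ , rel , l<1+e) =
      (((i , π i) , (i′ , π i′)) , P-π i , P-π i′ , distinct , cong₂ _,_ rows-diff cols-diff) , toℕ-fromℕ< (offset<k win)
      where
      i i′ : Fin k
      i  = fromℕ< (offset<k win)
      i′ = fromℕ< (offset<k win′)
      π-i : toℕ (π i) ≡ liftℕ π (a ∸ s)
      π-i = trans (sym (liftℕ-toℕ π i)) (cong (liftℕ π) (toℕ-fromℕ< (offset<k win)))
      π-i′ : toℕ (π i′) ≡ liftℕ π (a′ ∸ s)
      π-i′ = trans (sym (liftℕ-toℕ π i′)) (cong (liftℕ π) (toℕ-fromℕ< (offset<k win′)))
      rel′ : toℕ (π i′) + zeroRun a c ≡ toℕ (π i) + suc e
      rel′ = trans (cong (_+ zeroRun a c) π-i′) (trans rel (cong (_+ suc e) (sym π-i)))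
      distinct : (i , π i) ≢ (i′ , π i′)
      distinct same = <⇒≢ l<1+e (+-cancelˡ-≡ (toℕ (π i)) _ _ (trans (cong (λ x → toℕ (proj₂ x) + zeroRun a c) same) rel′))
      rows-diff : ⁺ toℕ i′ ℤ.- ⁺ toℕ i ≡ ⁺ a′ ℤ.- ⁺ a
      rows-diff = ⁺m-⁺n≡⁺o-⁺p (toℕ i′) (toℕ i) a′ a (begin
        toℕ i′ + a                ≡⟨ cong₂ _+_ (toℕ-fromℕ< (offset<k win′)) (sym (m∸n+n≡m (proj₁ win))) ⟩
        (a′ ∸ s) + ((a ∸ s) + s)  ≡⟨ x∙yz≈y∙xz (a′ ∸ s) (a ∸ s) s ⟩
        (a ∸ s) + ((a′ ∸ s) + s)  ≡⟨ cong₂ _+_ (sym (toℕ-fromℕ< (offset<k win))) (m∸n+n≡m (proj₁ win′)) ⟩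
        toℕ i + a′                ∎)
        where open ≡-Reasoning
      cols-diff : ⁺ toℕ (π i′) ℤ.- ⁺ toℕ (π i) ≡ ⁺ suc e ℤ.- ⁺ zeroRun a c
      cols-diff = ⁺m-⁺n≡⁺o-⁺p (toℕ (π i′)) (toℕ (π i)) (suc e) (zeroRun a c) rel′

    witness-fibre : ∀ M c a a′ e → count (witness? c a a′ e) M < r
    witness-fibre M c a a′ e = ≰⇒> λ r≤count → repeated (count≥⇒enumeration (witness? c a a′ e) M r≤count)
      where
      repeated : Enumeration (λ s → Witness s c a a′ e) M r → ⊥
      repeated (g , g<W , g-inj) = rf (witnessVector c a a′ e) (proj₁ ∘ pair , pair-inj)
        where
        pair : ∀ x → Σ (PairWithVec P (witnessVector c a a′ e)) _
        pair x = witnessPair (g x) (proj₂ (g<W x))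
        g≤a : ∀ x → g x ≤ a
        g≤a x = proj₁ (proj₁ (proj₂ (g<W x)))
        pair-inj : ∀ {x y} → proj₁ (proj₁ (pair x)) ≡ proj₁ (proj₁ (pair y)) → x ≡ y
        pair-inj {x} {y} same = g-inj (∸-cancelˡ-≡ (g≤a x) (g≤a y)
          (trans (sym (proj₂ (pair x))) (trans (cong (toℕ ∘ proj₁ ∘ proj₁) same) (proj₂ (pair y)))))

    ∑-windows : ∀ M c a a′ e → ∑[ s < M ] witnessTerm s c a a′ e ≤ isZero (A a c) * r * isZero (A a′ (c + suc e))
    ∑-windows M c a a′ e = begin
      ∑[ s < M ] witnessTerm s c a a′ e                ≡⟨ ∑<-*ˡ M x _ ⟩
      x * ∑[ s < M ] (y * isOne (does (witness? c a a′ e s)))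
                                               ≡⟨ cong (x *_) (∑<-*ˡ M y _) ⟩
      x * (y * count (witness? c a a′ e) M)     ≤⟨ *-monoʳ-≤ x (*-monoʳ-≤ y (<⇒≤ (witness-fibre M c a a′ e))) ⟩
      x * (y * r)                               ≡⟨ cong (x *_) (*-comm y r) ⟩
      x * (r * y)                               ≡⟨ *-assoc x r y ⟨
      x * r * y                                 ∎
      where
      open ≤-Reasoning
      x y : ℕ
      x = isZero (A a c)
      y = isZero (A a′ (c + suc e))

    ∑-partners : ∀ M c a → ∑[ a′ < N ] ∑[ e < Z ] ∑[ s < M ] witnessTerm s c a a′ e ≤ isZero (A a c) * r * (Z * Z)
    ∑-partners M c a = begin
      ∑[ a′ < N ] ∑[ e < Z ] ∑[ s < M ] witnessTerm s c a a′ e         ≤⟨ ∑<-mono-≤ N (λ a′ _ → ∑<-mono-≤ Z (λ e _ → ∑-windows M c a a′ e)) ⟩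
      ∑[ a′ < N ] ∑[ e < Z ] (xr * isZero (A a′ (c + suc e)))   ≡⟨ ∑<-cong N (λ a′ _ → ∑<-*ˡ Z xr _) ⟩
      ∑[ a′ < N ] (xr * ∑[ e < Z ] isZero (A a′ (c + suc e)))   ≡⟨ ∑<-*ˡ N xr _ ⟩
      xr * ∑[ a′ < N ] ∑[ e < Z ] isZero (A a′ (c + suc e))     ≡⟨ cong (xr *_) (∑<-comm N Z _) ⟩
      xr * ∑[ e < Z ] ∑[ a′ < N ] isZero (A a′ (c + suc e))     ≤⟨ *-monoʳ-≤ xr (∑<-≤-* Z _ Z (λ e _ → colZeros≤Z (c + suc e))) ⟩
      xr * (Z * Z)                                             ∎
      where
      open ≤-Reasoning
      xr : ℕ
      xr = isZero (A a c) * r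

    ∑-column : ∀ M c → ∑[ a < N ] ∑[ a′ < N ] ∑[ e < Z ] ∑[ s < M ] witnessTerm s c a a′ e ≤ r * (Z * Z) * Z
    ∑-column M c = begin
      ∑[ a < N ] ∑[ a′ < N ] ∑[ e < Z ] ∑[ s < M ] witnessTerm s c a a′ e  ≤⟨ ∑<-mono-≤ N (λ a _ → ∑-partners M c a) ⟩
      ∑[ a < N ] (isZero (A a c) * r * (Z * Z))                     ≡⟨ ∑<-cong N (λ a _ → trans (*-assoc (isZero (A a c)) r (Z * Z)) (*-comm (isZero (A a c)) (r * (Z * Z)))) ⟩
      ∑[ a < N ] (r * (Z * Z) * isZero (A a c))                     ≡⟨ ∑<-*ˡ N (r * (Z * Z)) _ ⟩
      r * (Z * Z) * ∑[ a < N ] isZero (A a c)                       ≤⟨ *-monoʳ-≤ (r * (Z * Z)) (colZeros≤Z c) ⟩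
      r * (Z * Z) * Z                                               ∎
      where open ≤-Reasoning

    upperBound : ∀ M → ∑[ s < M ] ∑[ c < N ] witnesses s c ≤ N * (r * (Z * Z) * Z)
    upperBound M = begin
      ∑[ s < M ] ∑[ c < N ] witnesses s c                                  ≡⟨ windowsInnermost ⟩
      ∑[ c < N ] ∑[ a < N ] ∑[ a′ < N ] ∑[ e < Z ] ∑[ s < M ] witnessTerm s c a a′ e ≤⟨ ∑<-≤-* N _ _ (λ c _ → ∑-column M c) ⟩
      N * (r * (Z * Z) * Z)                                                ∎
      where
      open ≤-Reasoning
      windowsInnermost : ∑[ s < M ] ∑[ c < N ] witnesses s c ≡
                         ∑[ c < N ] ∑[ a < N ] ∑[ a′ < N ] ∑[ e < Z ] ∑[ s < M ] witnessTerm s c a a′ e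
      windowsInnermost = trans (∑<-comm M N witnesses)
        (∑<-cong N λ c _ → trans (∑<-comm M N _)
        (∑<-cong N λ a _ → trans (∑<-comm M N _)
        (∑<-cong N λ a′ _ → ∑<-comm M Z _)))

maxZeroCount : ∀ {m n} (B : BMatrix m n) {Q : ℕ → Set} → Q 0 →
  (∀ i → Q (zerosInRow B i)) → (∀ j → Q (zerosInCol B j)) →
  ∃ λ Z → Q Z × (∀ i → zerosInRow B i ≤ Z) × (∀ j → zerosInCol B j ≤ Z)
maxZeroCount B {Q} Q0 Q-row Q-col =
  Z , argmax-all id {P = Q} Q0 (++⁺ (tabulate⁺ Q-row) (tabulate⁺ Q-col)) , tabulate⁻ ≤-rows , tabulate⁻ ≤-cols
  where
  counts : List ℕ
  counts = tabulate (zerosInRow B) ++ tabulate (zerosInCol B)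
  Z : ℕ
  Z = max 0 counts
  ≤-rows : All (_≤ Z) (tabulate (zerosInRow B))
  ≤-rows = proj₁ (++⁻ (tabulate (zerosInRow B)) (xs≤max 0 counts))
  ≤-cols : All (_≤ Z) (tabulate (zerosInCol B))
  ≤-cols = proj₂ (++⁻ (tabulate (zerosInRow B)) (xs≤max 0 counts))

module Theorem {k r} (r≥3 : 3 ≤ r) (B : BMatrix (3 * k) (3 * k)) {P : BMatrix k k} (perm : IsPermMatrix P)
  (rf : RepetitionFree r P) {Z} (bound : ZeroBound k r Z)
  (rowZ : ∀ i → zerosInRow B i ≤ Z) (colZ : ∀ j → zerosInCol B j ≤ Z) where

  rowZeros≤Z : ∀ a → a < 3 * k → ∑[ c < 3 * k ] isZero (extend B a c) ≤ Z
  rowZeros≤Z a a<N = subst (λ x → ∑[ c < 3 * k ] isZero (extend B x c) ≤ Z) (toℕ-fromℕ< a<N)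
    (subst (_≤ Z) (zerosInRow≡∑ B (fromℕ< a<N)) (rowZ (fromℕ< a<N)))

  colZeros≤Z : ∀ c → ∑[ a < 3 * k ] isZero (extend B a c) ≤ Z
  colZeros≤Z c = byCases (c <? 3 * k)
    where
    byCases : Dec (c < 3 * k) → ∑[ a < 3 * k ] isZero (extend B a c) ≤ Z
    byCases (yes c<N) = subst (λ x → ∑[ a < 3 * k ] isZero (extend B a x) ≤ Z) (toℕ-fromℕ< c<N)
      (subst (_≤ Z) (zerosInCol≡∑ B (fromℕ< c<N)) (colZ (fromℕ< c<N)))
    byCases (no c≮N) = ≤-trans (≤-reflexive no-zeros) z≤n
      where
      no-zeros : ∑[ a < 3 * k ] isZero (extend B a c) ≡ 0
      no-zeros = trans (∑<-cong (3 * k) (λ a _ → cong isZero (extend-outside B a c (c≮N ∘ proj₂))))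
                       (trans (∑<-const (3 * k) 0) (*-zeroʳ (3 * k)))

  open WitnessCounting k B perm Z rowZeros≤Z colZeros≤Z
  open RepetitionFreeBound r rf

  windows : ℕ
  windows = suc (2 * k)

  window-fits : ∀ {s} → s < windows → s + k ≤ N
  window-fits {s} s<windows = ≤-trans (+-monoˡ-≤ k (s≤s⁻¹ s<windows)) (≤-reflexive (+-comm (2 * k) k))

  81Z≤k : 81 * Z ≤ k
  81Z≤k = zeroBound⇒81Z≤k {k} {r} {Z} r≥3 bound

  Z≤N : Z ≤ N
  Z≤N = ≤-trans (m≤n*m Z 81) (≤-trans 81Z≤k (m≤n*m k 3))

  someWindowSucceeds : ¬ (∀ s → s < windows → matched s N < k)
  someWindowSucceeds fails = manyWindows-arith k Z (r * (Z * Z) * Z) 81Z≤k (zeroBound⇒27rZ³≤k {k} {r} {Z} bound) (begin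
    windows * (k + 2)                                         ≡⟨ ∑<-const windows (k + 2) ⟨
    ∑[ s < windows ] (k + 2)                                  ≤⟨ ∑<-mono-≤ windows (λ s s< → FailingWindow.lowerBound s (window-fits s<) (fails s s<) Z≤N) ⟩
    ∑[ s < windows ] (∑[ c < N ] witnesses s c + Z)           ≡⟨ ∑<-distrib-+ windows (λ s → ∑[ c < N ] witnesses s c) (λ _ → Z) ⟩
    ∑[ s < windows ] ∑[ c < N ] witnesses s c + ∑[ s < windows ] Z
                                                              ≤⟨ +-mono-≤ (upperBound windows) (≤-reflexive (∑<-const windows Z)) ⟩
    N * (r * (Z * Z) * Z) + windows * Z                       ∎)
    where open ≤-Reasoning

  consecutiveOccurrence : Σ (Occurrence B P) (UsesConsecutiveRows B P)
  consecutiveOccurrence with any? (λ (s : Fin windows) → k ≤? matched (toℕ s) N)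
  ... | yes (s , k≤m) = occurrence (toℕ s) (window-fits (toℕ<n s)) k≤m
  ... | no  none      = ⊥-elim (someWindowSucceeds λ s s<windows → ≰⇒> λ k≤m →
    none (fromℕ< s<windows , subst (λ x → k ≤ matched x N) (sym (toℕ-fromℕ< s<windows)) k≤m))

lemma4p2 : (k r : ℕ) → 9 ≤ k → 3 ≤ r →
    (B : BMatrix (3 * k) (3 * k)) → (P : BMatrix k k) →
    IsPermMatrix P → RepetitionFree r P →
    ((i : Fin (3 * k)) → ZeroBound k r (zerosInRow B i)) →
    ((j : Fin (3 * k)) → ZeroBound k r (zerosInCol B j)) →
    Contains B P × Σ (Occurrence B P) (λ o → UsesConsecutiveRows B P o)
lemma4p2 k r _ r≥3 B P perm rf rowBound colBound = proj₁ occ , occ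
  where
  occ : Σ (Occurrence B P) (UsesConsecutiveRows B P)
  occ with maxZeroCount B {ZeroBound k r} z≤n rowBound colBound
  ... | _ , bound , rowZ , colZ = Theorem.consecutiveOccurrence r≥3 B perm rf bound rowZ colZ
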